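{- Let $K$ be a Kripke structure and $t,t'$ states of $K$. (1) If $t$ and $t'$ are bisimilar, then $t$ and $t'$ are indistinguishable by CTL+Sync formulas without the Next operators (even when extended with sequences of unary temporal operators). (2) If $t$ and $t'$ are indistinguishable by CTL+Sync formulas without the Next operators (even when extended with sequences of unary temporal operators), then $t$ and $t'$ are stuttering bisimilar.
   Context: A Kripke structure is $K=\langle T,\Pi,\pi,R\rangle$ with $T$ a finite set of states, $\Pi$ a finite set of atomic propositions, $\pi:T\to 2^{\Pi}$ a labeling, $R\subseteq T\times T$ a transition relation; $R(t)=\{t'\mid(t,t')\in R\}$. A path is an infinite sequence $t_0t_1\dots$ with $(t_i,t_{i+1})\in R$. Two states are indistinguishable by a logic if they satisfy exactly the same formulas of that logic. Bisimilarity: $t,t'$ are bisimilar if related by a relation $B\subseteq T\times T$ such that whenever $(u,v)\in B$: $\pi(u)=\pi(v)$, every $u'\in R(u)$ has some $v'\in R(v)$ with $(u',v')\in B$, and every $v'\in R(v)$ has some $u'\in R(u)$ with $(u',v')\in B$. Stuttering bisimilarity is (equivalently) indistinguishability by CTL formulas without the Next operator, i.e. formulas built from atomic propositions, $\neg$, $\lor$, $\exists\mathcal U$ and $\forall\mathcal U$ (with the standard CTL semantics below). CTL+Sync formulas without Next: $\varphi ::= p \mid \neg\varphi_1 \mid \varphi_1\lor\varphi_2 \mid \varphi_1\,\exists\mathcal U\,\varphi_2 \mid \varphi_1\,\forall\mathcal U\,\varphi_2 \mid \varphi_1\,\mathcal U\exists\,\varphi_2 \mid \varphi_1\,\mathcal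 U\forall\,\varphi_2$, $p\in\Pi$, with semantics: standard for $p,\neg,\lor$; $\varphi_1\exists\mathcal U\varphi_2$: some path from $t$ has a $k$ with $\varphi_2$ at position $k$ and $\varphi_1$ at all positions $j<k$; $\varphi_1\forall\mathcal U\varphi_2$: every path from $t$ has such a $k$; $\varphi_1\,\mathcal U\exists\,\varphi_2$: there exists $k\ge0$ such that for all $0\le j<k$ some path $t_0t_1\dots$ from $t$ has $K,t_j\models\varphi_1$ and $K,t_k\models\varphi_2$; $\varphi_1\,\mathcal U\forall\,\varphi_2$: there exists $k\ge0$ such that for all $0\le j<k$ and all paths $t_0t_1\dots$ from $t$, $K,t_j\models\varphi_1$ and $K,t_k\models\varphi_2$. The extension with sequences of unary temporal operators adds formulas $\mathcal T Q\varphi_1$ with $\mathcal T=O_1\cdots O_m\in\{F,G\}^+$, $Q\in\{\exists,\forall\}$, where $K,t\models O_1\cdots O_m Q\varphi_1$ iff $\mathsf Q_1 k_1\ge 0\ \mathsf Q_2 k_2\ge k_1\cdots \mathsf Q_m k_m\ge k_{m-1}$ such that for $Q$ (some/all) paths $t_0t_1\dots$ with $t_0=t$, $K,t_{k_m}\models\varphi_1$, with $\mathsf Q_i$ "there exists" if $O_i=F$ and "for all" if $O_i=G$. -}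

module Defs where

open import Data.Nat using (ℕ; zero; suc; _≤_; _<_)
open import Data.Fin using (Fin)
open import Data.Fin.Subset using (Subset)
open import Data.Bool using (Bool; true)
open import Data.List using (List; []; _∷_)
open import Data.List.NonEmpty using (List⁺; toList)
open import Data.Product using (Σ; _×_; ∃)
open import Data.Sum using (_⊎_)
open import Relation.Nullary using (¬_)
open import Relation.Binary.PropositionalEquality using (_≡_)
open import Function.Bundles using (_⇔_)

record Kripke (n m : ℕ) : Set where
  field
    π : Fin n → Subset m
    R : Fin n → Fin n → Bool

module _ {n m : ℕ} (K : Kripke n m) where
  open Kripke K

  record Path (t : Fin n) : Set where
    field
      st    : ℕ → Fin n
      start : st 0 ≡ t
      step  : ∀ i → R (st i) (st (suc i)) ≡ true
  open Path public

  IsBisimulation : (Fin n → Fin n → Set) → Set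
  IsBisimulation B = ∀ u v → B u v →
      (π u ≡ π v)
    × (∀ u' → R u u' ≡ true → Σ (Fin n) λ v' → R v v' ≡ true × B u' v')
    × (∀ v' → R v v' ≡ true → Σ (Fin n) λ u' → R u u' ≡ true × B u' v')

  Bisimilar : Fin n → Fin n → Set₁
  Bisimilar t t' = Σ (Fin n → Fin n → Set) λ B → IsBisimulation B × B t t'

data PathQ : Set where
  ∃P ∀P : PathQ

data UOp : Set where
  F G : UOp

data CTL (m : ℕ) : Set where
  prop : Fin m → CTL m
  ¬′_  : CTL m → CTL m
  _∨′_ : CTL m → CTL m → CTL m
  _∃U_ : CTL m → CTL m → CTL m
  _∀U_ : CTL m → CTL m → CTL m

data Sync (m : ℕ) : Set where
  prop : Fin m → Sync m
  ¬′_  : Sync m → Sync m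
  _∨′_ : Sync m → Sync m → Sync m
  _∃U_ : Sync m → Sync m → Sync m
  _∀U_ : Sync m → Sync m → Sync m
  _U∃_ : Sync m → Sync m → Sync m
  _U∀_ : Sync m → Sync m → Sync m

data SyncT (m : ℕ) : Set where
  prop : Fin m → SyncT m
  ¬′_  : SyncT m → SyncT m
  _∨′_ : SyncT m → SyncT m → SyncT m
  _∃U_ : SyncT m → SyncT m → SyncT m
  _∀U_ : SyncT m → SyncT m → SyncT m
  _U∃_ : SyncT m → SyncT m → SyncT m
  _U∀_ : SyncT m → SyncT m → SyncT m
  seq  : List⁺ UOp → PathQ → SyncT m → SyncT m

module Semantics {n m : ℕ} (K : Kripke n m) where
  open Kripke K
  open import Data.Fin.Subset using (_∈_)

  EU AU : (Fin n → Set) → (Fin n → Set) → Fin n → Set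
  EU s₁ s₂ t = Σ (Path K t) λ p → Σ ℕ λ k →
    s₂ (st p k) × (∀ j → j < k → s₁ (st p j))
  AU s₁ s₂ t = (p : Path K t) → Σ ℕ λ k →
    s₂ (st p k) × (∀ j → j < k → s₁ (st p j))

  UE UA : (Fin n → Set) → (Fin n → Set) → Fin n → Set
  UE s₁ s₂ t = Σ ℕ λ k →
      (Σ (Path K t) λ p → s₂ (st p k))
    × (∀ j → j < k → Σ (Path K t) λ p → s₁ (st p j) × s₂ (st p k))
  UA s₁ s₂ t = Σ ℕ λ k → (p : Path K t) →
    s₂ (st p k) × (∀ j → j < k → s₁ (st p j))

  -- O₁⋯Oₘ Q φ, with current lower bound k for the next position
  Ops : List UOp → PathQ → (Fin n → Set) → Fin n → ℕ → Set
  Ops [] ∃P s t k = Σ (Path K t) λ p → s (st p k)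
  Ops [] ∀P s t k = (p : Path K t) → s (st p k)
  Ops (F ∷ os) Q s t k = Σ ℕ λ k' → k ≤ k' × Ops os Q s t k'
  Ops (G ∷ os) Q s t k = ∀ k' → k ≤ k' → Ops os Q s t k'

  infix 4 _⊨ᶜ_ _⊨ˢ_ _⊨ᵗ_

  _⊨ᶜ_ : Fin n → CTL m → Set
  t ⊨ᶜ prop a = a ∈ π t
  t ⊨ᶜ (¬′ φ) = ¬ (t ⊨ᶜ φ)
  t ⊨ᶜ (φ ∨′ ψ) = (t ⊨ᶜ φ) ⊎ (t ⊨ᶜ ψ)
  t ⊨ᶜ (φ ∃U ψ) = EU (_⊨ᶜ φ) (_⊨ᶜ ψ) t
  t ⊨ᶜ (φ ∀U ψ) = AU (_⊨ᶜ φ) (_⊨ᶜ ψ) t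

  _⊨ˢ_ : Fin n → Sync m → Set
  t ⊨ˢ prop a = a ∈ π t
  t ⊨ˢ (¬′ φ) = ¬ (t ⊨ˢ φ)
  t ⊨ˢ (φ ∨′ ψ) = (t ⊨ˢ φ) ⊎ (t ⊨ˢ ψ)
  t ⊨ˢ (φ ∃U ψ) = EU (_⊨ˢ φ) (_⊨ˢ ψ) t
  t ⊨ˢ (φ ∀U ψ) = AU (_⊨ˢ φ) (_⊨ˢ ψ) t
  t ⊨ˢ (φ U∃ ψ) = UE (_⊨ˢ φ) (_⊨ˢ ψ) t
  t ⊨ˢ (φ U∀ ψ) = UA (_⊨ˢ φ) (_⊨ˢ ψ) t

  _⊨ᵗ_ : Fin n → SyncT m → Set
  t ⊨ᵗ prop a = a ∈ π t
  t ⊨ᵗ (¬′ φ) = ¬ (t ⊨ᵗ φ)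
  t ⊨ᵗ (φ ∨′ ψ) = (t ⊨ᵗ φ) ⊎ (t ⊨ᵗ ψ)
  t ⊨ᵗ (φ ∃U ψ) = EU (_⊨ᵗ φ) (_⊨ᵗ ψ) t
  t ⊨ᵗ (φ ∀U ψ) = AU (_⊨ᵗ φ) (_⊨ᵗ ψ) t
  t ⊨ᵗ (φ U∃ ψ) = UE (_⊨ᵗ φ) (_⊨ᵗ ψ) t
  t ⊨ᵗ (φ U∀ ψ) = UA (_⊨ᵗ φ) (_⊨ᵗ ψ) t
  t ⊨ᵗ seq os Q φ = Ops (toList os) Q (_⊨ᵗ φ) t 0

  IndistCTL IndistSync IndistSyncT : Fin n → Fin n → Set
  IndistCTL t t' = (φ : CTL m) → (t ⊨ᶜ φ) ⇔ (t' ⊨ᶜ φ)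
  IndistSync t t' = (φ : Sync m) → (t ⊨ˢ φ) ⇔ (t' ⊨ˢ φ)
  IndistSyncT t t' = (φ : SyncT m) → (t ⊨ᵗ φ) ⇔ (t' ⊨ᵗ φ)

  -- Stuttering bisimilarity, defined (as in the paper's context) as
  -- indistinguishability by CTL formulas without Next.
  StutteringBisimilar : Fin n → Fin n → Set
  StutteringBisimilar = IndistCTL

-- A bisimulation lets every path from one state be matched, position by
-- position, by a path from the other through related states.  All path
-- operators of CTL+Sync (and the unary sequences O₁⋯Oₘ Q) only inspect the
-- states at positions of paths, so satisfaction of every formula is invariant
-- under a bisimulation; negation is handled by the converse relation, which is
-- again a bisimulation.  Conversely, CTL without Next is a fragment of both
-- logics with the same semantics, so indistinguishability by either logic
-- implies indistinguishability by CTL without Next.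
module Submission where

open import Defs
open import Data.Nat using (ℕ; zero; suc; _<_)
open import Data.Fin using (Fin)
open import Data.Fin.Subset using (_∈_)
open import Data.Bool using (true)
open import Data.List using ([]; _∷_)
open import Data.List.NonEmpty using (toList)
open import Data.Product using (Σ; _×_; _,_; proj₁; proj₂)
import Data.Sum as Sum
open import Data.Sum.Function.Propositional using (_⊎-⇔_)
open import Function using (flip)
open import Function.Bundles using (_⇔_; mk⇔; Equivalence)
open import Function.Construct.Composition using (_⇔-∘_)
open import Function.Construct.Identity using (⇔-id)
open import Function.Construct.Symmetry using (⇔-sym)
open import Function.Related.TypeIsomorphisms using (¬-cong-⇔)
open import Relation.Binary.Definitions using (_Respects_)
open import Relation.Binary.PropositionalEquality using (_≡_; refl; sym; subst)
open import Relation.Unary using (_⊆′_)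

module _ {n m : ℕ} {K : Kripke n m} where
  open Kripke K
  open Semantics K

  private variable
    s s₁ s₂ s₁' s₂' : Fin n → Set
    B : Fin n → Fin n → Set
    u v : Fin n
    σ τ : ℕ → Fin n

  isBisimulation-flip : IsBisimulation K B → IsBisimulation K (flip B)
  isBisimulation-flip isB u v b =
    let (πv≡πu , forth , back) = isB v u b in sym πv≡πu , back , forth

  liftPath : IsBisimulation K B → B u v → (p : Path K u) →
             Σ (Path K v) λ q → ∀ i → B (st p i) (st q i)
  liftPath {B} {v = v} isB b p = q , λ i → proj₂ (partner i)
    where
    forth : ∀ {u v u'} → B u v → R u u' ≡ true →
            Σ (Fin n) λ v' → R v v' ≡ true × B u' v'
    forth b = proj₁ (proj₂ (isB _ _ b)) _

    partner : ∀ i → Σ (Fin n) (B (st p i))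
    partner zero = v , subst (λ u → B u v) (sym (start p)) b
    partner (suc i) =
      let (w , _ , b') = forth (proj₂ (partner i)) (step p i) in w , b'

    q : Path K v
    q = record
      { st    = λ i → proj₁ (partner i)
      ; start = refl
      ; step  = λ i → proj₁ (proj₂ (forth (proj₂ (partner i)) (step p i)))
      }

  liftPathBack : IsBisimulation K B → B u v → (q : Path K v) →
                 Σ (Path K u) λ p → ∀ i → B (st p i) (st q i)
  liftPathBack isB b = liftPath (isBisimulation-flip isB) b

  UntilAt : (Fin n → Set) → (Fin n → Set) → (ℕ → Fin n) → ℕ → Set
  UntilAt s₁ s₂ σ k = s₂ (σ k) × (∀ j → j < k → s₁ (σ j))

  untilAt-mono : s₁ ⊆′ s₁' → s₂ ⊆′ s₂' →
                 ∀ σ k → UntilAt s₁ s₂ σ k → UntilAt s₁' s₂' σ k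
  untilAt-mono f g σ k (h₂ , h₁) = g (σ k) h₂ , λ j j<k → f (σ j) (h₁ j j<k)

  module _ {B : Fin n → Fin n → Set} where

    untilAt-transport : s₁ Respects B → s₂ Respects B → (∀ i → B (σ i) (τ i)) →
                        ∀ k → UntilAt s₁ s₂ σ k → UntilAt s₁ s₂ τ k
    untilAt-transport r₁ r₂ στ k (h₂ , h₁) =
      r₂ (στ k) h₂ , λ j j<k → r₁ (στ j) (h₁ j j<k)

    module _ (isB : IsBisimulation K B) where

      ∈π-respects : ∀ a → (λ t → a ∈ π t) Respects B
      ∈π-respects a b = subst (a ∈_) (proj₁ (isB _ _ b))

      EU-respects : s₁ Respects B → s₂ Respects B →
                    EU s₁ s₂ Respects B
      EU-respects r₁ r₂ b (p , k , h) =
        let (q , pq) = liftPath isB b p in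
        q , k , untilAt-transport r₁ r₂ pq k h

      AU-respects : s₁ Respects B → s₂ Respects B →
                    AU s₁ s₂ Respects B
      AU-respects r₁ r₂ b h q =
        let (p , pq) = liftPathBack isB b q ; (k , hp) = h p in
        k , untilAt-transport r₁ r₂ pq k hp

      UE-respects : s₁ Respects B → s₂ Respects B →
                    UE s₁ s₂ Respects B
      UE-respects r₁ r₂ b (k , (p , h₂) , h₁) =
        k , (let (q , pq) = liftPath isB b p in q , r₂ (pq k) h₂) ,
        λ j j<k → let (p' , h₁' , h₂') = h₁ j j<k ; (q , pq) = liftPath isB b p' in
                  q , r₁ (pq j) h₁' , r₂ (pq k) h₂'

      UA-respects : s₁ Respects B → s₂ Respects B →
                    UA s₁ s₂ Respects B
      UA-respects r₁ r₂ b (k , h) =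
        k , λ q → let (p , pq) = liftPathBack isB b q in
                  untilAt-transport r₁ r₂ pq k (h p)

      Ops-respects : ∀ os Q → s Respects B → ∀ k → (λ t → Ops os Q s t k) Respects B
      Ops-respects [] ∃P r k b (p , h) =
        let (q , pq) = liftPath isB b p in q , r (pq k) h
      Ops-respects [] ∀P r k b h q =
        let (p , pq) = liftPathBack isB b q in r (pq k) (h p)
      Ops-respects (F ∷ os) Q r k b (k' , k≤k' , h) =
        k' , k≤k' , Ops-respects os Q r k' b h
      Ops-respects (G ∷ os) Q r k b h k' k≤k' =
        Ops-respects os Q r k' b (h k' k≤k')

  ⊨ˢ-respects : ∀ φ → IsBisimulation K B → (_⊨ˢ φ) Respects B
  ⊨ˢ-respects (prop a)  isB = ∈π-respects isB a
  ⊨ˢ-respects (¬′ φ)    isB b ¬su sv = ¬su (⊨ˢ-respects φ (isBisimulation-flip isB) b sv)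
  ⊨ˢ-respects (φ ∨′ ψ)  isB b = Sum.map (⊨ˢ-respects φ isB b) (⊨ˢ-respects ψ isB b)
  ⊨ˢ-respects (φ ∃U ψ)  isB = EU-respects isB (⊨ˢ-respects φ isB) (⊨ˢ-respects ψ isB)
  ⊨ˢ-respects (φ ∀U ψ)  isB = AU-respects isB (⊨ˢ-respects φ isB) (⊨ˢ-respects ψ isB)
  ⊨ˢ-respects (φ U∃ ψ)  isB = UE-respects isB (⊨ˢ-respects φ isB) (⊨ˢ-respects ψ isB)
  ⊨ˢ-respects (φ U∀ ψ)  isB = UA-respects isB (⊨ˢ-respects φ isB) (⊨ˢ-respects ψ isB)

  ⊨ᵗ-respects : ∀ φ → IsBisimulation K B → (_⊨ᵗ φ) Respects B
  ⊨ᵗ-respects (prop a)     isB = ∈π-respects isB a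
  ⊨ᵗ-respects (¬′ φ)       isB b ¬su sv = ¬su (⊨ᵗ-respects φ (isBisimulation-flip isB) b sv)
  ⊨ᵗ-respects (φ ∨′ ψ)     isB b = Sum.map (⊨ᵗ-respects φ isB b) (⊨ᵗ-respects ψ isB b)
  ⊨ᵗ-respects (φ ∃U ψ)     isB = EU-respects isB (⊨ᵗ-respects φ isB) (⊨ᵗ-respects ψ isB)
  ⊨ᵗ-respects (φ ∀U ψ)     isB = AU-respects isB (⊨ᵗ-respects φ isB) (⊨ᵗ-respects ψ isB)
  ⊨ᵗ-respects (φ U∃ ψ)     isB = UE-respects isB (⊨ᵗ-respects φ isB) (⊨ᵗ-respects ψ isB)
  ⊨ᵗ-respects (φ U∀ ψ)     isB = UA-respects isB (⊨ᵗ-respects φ isB) (⊨ᵗ-respects ψ isB)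
  ⊨ᵗ-respects (seq os Q φ) isB = Ops-respects isB (toList os) Q (⊨ᵗ-respects φ isB) 0

  bisimilar⇒indistSync : ∀ {t t'} → Bisimilar K t t' → IndistSync t t'
  bisimilar⇒indistSync (B , isB , b) φ =
    mk⇔ (⊨ˢ-respects φ isB b) (⊨ˢ-respects φ (isBisimulation-flip isB) b)

  bisimilar⇒indistSyncT : ∀ {t t'} → Bisimilar K t t' → IndistSyncT t t'
  bisimilar⇒indistSyncT (B , isB , b) φ =
    mk⇔ (⊨ᵗ-respects φ isB b) (⊨ᵗ-respects φ (isBisimulation-flip isB) b)

  EU-mono : s₁ ⊆′ s₁' → s₂ ⊆′ s₂' → EU s₁ s₂ ⊆′ EU s₁' s₂'
  EU-mono f g t (p , k , h) = p , k , untilAt-mono f g (st p) k h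

  AU-mono : s₁ ⊆′ s₁' → s₂ ⊆′ s₂' → AU s₁ s₂ ⊆′ AU s₁' s₂'
  AU-mono f g t h p = let (k , hp) = h p in k , untilAt-mono f g (st p) k hp

  EU-cong : (∀ t → s₁ t ⇔ s₁' t) → (∀ t → s₂ t ⇔ s₂' t) →
            ∀ t → EU s₁ s₂ t ⇔ EU s₁' s₂' t
  EU-cong e₁ e₂ t = mk⇔
    (EU-mono (λ u → Equivalence.to (e₁ u)) (λ u → Equivalence.to (e₂ u)) t)
    (EU-mono (λ u → Equivalence.from (e₁ u)) (λ u → Equivalence.from (e₂ u)) t)

  AU-cong : (∀ t → s₁ t ⇔ s₁' t) → (∀ t → s₂ t ⇔ s₂' t) →
            ∀ t → AU s₁ s₂ t ⇔ AU s₁' s₂' t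
  AU-cong e₁ e₂ t = mk⇔
    (AU-mono (λ u → Equivalence.to (e₁ u)) (λ u → Equivalence.to (e₂ u)) t)
    (AU-mono (λ u → Equivalence.from (e₁ u)) (λ u → Equivalence.from (e₂ u)) t)

  toSync : CTL m → Sync m
  toSync (prop a) = prop a
  toSync (¬′ φ)   = ¬′ toSync φ
  toSync (φ ∨′ ψ) = toSync φ ∨′ toSync ψ
  toSync (φ ∃U ψ) = toSync φ ∃U toSync ψ
  toSync (φ ∀U ψ) = toSync φ ∀U toSync ψ

  toSyncT : CTL m → SyncT m
  toSyncT (prop a) = prop a
  toSyncT (¬′ φ)   = ¬′ toSyncT φ
  toSyncT (φ ∨′ ψ) = toSyncT φ ∨′ toSyncT ψ
  toSyncT (φ ∃U ψ) = toSyncT φ ∃U toSyncT ψ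
  toSyncT (φ ∀U ψ) = toSyncT φ ∀U toSyncT ψ

  ⊨ᶜ⇔⊨ˢ-toSync : ∀ φ t → (t ⊨ᶜ φ) ⇔ (t ⊨ˢ toSync φ)
  ⊨ᶜ⇔⊨ˢ-toSync (prop a) t = ⇔-id _
  ⊨ᶜ⇔⊨ˢ-toSync (¬′ φ)   t = ¬-cong-⇔ (⊨ᶜ⇔⊨ˢ-toSync φ t)
  ⊨ᶜ⇔⊨ˢ-toSync (φ ∨′ ψ) t = ⊨ᶜ⇔⊨ˢ-toSync φ t ⊎-⇔ ⊨ᶜ⇔⊨ˢ-toSync ψ t
  ⊨ᶜ⇔⊨ˢ-toSync (φ ∃U ψ) = EU-cong (⊨ᶜ⇔⊨ˢ-toSync φ) (⊨ᶜ⇔⊨ˢ-toSync ψ)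
  ⊨ᶜ⇔⊨ˢ-toSync (φ ∀U ψ) = AU-cong (⊨ᶜ⇔⊨ˢ-toSync φ) (⊨ᶜ⇔⊨ˢ-toSync ψ)

  ⊨ᶜ⇔⊨ᵗ-toSyncT : ∀ φ t → (t ⊨ᶜ φ) ⇔ (t ⊨ᵗ toSyncT φ)
  ⊨ᶜ⇔⊨ᵗ-toSyncT (prop a) t = ⇔-id _
  ⊨ᶜ⇔⊨ᵗ-toSyncT (¬′ φ)   t = ¬-cong-⇔ (⊨ᶜ⇔⊨ᵗ-toSyncT φ t)
  ⊨ᶜ⇔⊨ᵗ-toSyncT (φ ∨′ ψ) t = ⊨ᶜ⇔⊨ᵗ-toSyncT φ t ⊎-⇔ ⊨ᶜ⇔⊨ᵗ-toSyncT ψ t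
  ⊨ᶜ⇔⊨ᵗ-toSyncT (φ ∃U ψ) = EU-cong (⊨ᶜ⇔⊨ᵗ-toSyncT φ) (⊨ᶜ⇔⊨ᵗ-toSyncT ψ)
  ⊨ᶜ⇔⊨ᵗ-toSyncT (φ ∀U ψ) = AU-cong (⊨ᶜ⇔⊨ᵗ-toSyncT φ) (⊨ᶜ⇔⊨ᵗ-toSyncT ψ)

  indistSync⇒stutteringBisimilar : ∀ {t t'} → IndistSync t t' → StutteringBisimilar t t'
  indistSync⇒stutteringBisimilar {t} {t'} I φ =
    ⇔-sym (⊨ᶜ⇔⊨ˢ-toSync φ t') ⇔-∘ (I (toSync φ) ⇔-∘ ⊨ᶜ⇔⊨ˢ-toSync φ t)

  indistSyncT⇒stutteringBisimilar : ∀ {t t'} → IndistSyncT t t' → StutteringBisimilar t t'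
  indistSyncT⇒stutteringBisimilar {t} {t'} I φ =
    ⇔-sym (⊨ᶜ⇔⊨ᵗ-toSyncT φ t') ⇔-∘ (I (toSyncT φ) ⇔-∘ ⊨ᶜ⇔⊨ᵗ-toSyncT φ t)

theorem5 : {n m : ℕ} (K : Kripke n m) (t t' : Fin n) →
    let open Semantics K in
      (Bisimilar K t t' → IndistSync t t')
    × (Bisimilar K t t' → IndistSyncT t t')
    × (IndistSync t t' → StutteringBisimilar t t')
    × (IndistSyncT t t' → StutteringBisimilar t t')
theorem5 K t t' =
    bisimilar⇒indistSync
  , bisimilar⇒indistSyncT
  , indistSync⇒stutteringBisimilar
  , indistSyncT⇒stutteringBisimilar
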